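{- $R_{6}(VS) > 333$. That is, there is a $6$-coloring of $[333]$ in which no two distinct integers of the same color differ by $x^2$ for any positive integer $x$.
   Context: For $n\in\mathbb{N}$, $[n]=\{1,\dots,n\}$; a $c$-coloring of $[n]$ is a function $[n]\to[c]$. For a positive integer $c$, $R_c(VS)$ (the "van der Square" number) is the least positive integer $n$ such that every $c$-coloring of $[n]$ contains two integers $a<b$ in $[n]$ of the same color with $b-a=x^2$ for some positive integer $x$. -}

module Defs where

open import Data.Nat using (ℕ; suc; _+_; _*_; _<_)
open import Data.Fin using (Fin; toℕ)
open import Data.Product using (∃-syntax; Σ-syntax; _×_)
open import Data.Empty using (⊥)
open import Relation.Binary.PropositionalEquality using (_≡_; _≢_)

-- A c-coloring of [n] = {1,…,n}. The element i : Fin n represents the integer (toℕ i + 1).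
Coloring : ℕ → ℕ → Set
Coloring c n = Fin n → Fin c

SquareDiff : ℕ → ℕ → Set
SquareDiff a b = ∃[ x ] (b ≡ a + suc x * suc x)

HasMonoSquarePair : ∀ {c n} → Coloring c n → Set
HasMonoSquarePair {n = n} χ =
  Σ[ i ∈ Fin n ] Σ[ j ∈ Fin n ] (SquareDiff (suc (toℕ i)) (suc (toℕ j)) × χ i ≡ χ j)

VdSquareExceeds : ℕ → ℕ → Set
VdSquareExceeds c n = ∃[ χ ] (HasMonoSquarePair {c} {n} χ → ⊥)

module Submission where

-- Two integers of [n] differing by (x+1)² force (x+1)² < n, so once n ≤ (k+1)² a
-- monochromatic square pair exists iff one exists among the finitely many starting
-- points a ∈ [n] and roots x < k.  That search is decidable, and run on the explicit
-- coloring below (n = 333, k = 18, as 19² = 361 ≥ 333) it finds nothing.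

open import Defs
open import Data.Nat using (ℕ; suc; _+_; _*_; _<_; _≤_; s≤s; _<?_; _≤?_)
open import Data.Nat.Properties using (*-mono-≤; m≤n+m; ≤-trans; ≰⇒>; <⇒≱; suc-injective)
open import Data.Fin using (Fin; toℕ; fromℕ<)
open import Data.Fin.Properties using (_≟_; any?; toℕ<n; toℕ-fromℕ<; toℕ-injective)
import Data.Nat.Literals as ℕ
import Data.Fin.Literals as Fin
open import Data.Vec using (Vec; []; _∷_; lookup)
open import Data.Product using (_,_; ∃-syntax; Σ-syntax; _×_)
open import Relation.Nullary using (Dec; yes; no)
open import Relation.Nullary.Decidable using (map′; from-yes; from-no)
open import Relation.Binary.PropositionalEquality using (_≡_; cong; sym; trans; subst)
open import Agda.Builtin.FromNat using (Number; fromNat)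
open import Data.Unit using (tt)

square⁺ : ℕ → ℕ
square⁺ x = suc x * suc x

square⁺-mono-≤ : ∀ {x y} → x ≤ y → square⁺ x ≤ square⁺ y
square⁺-mono-≤ x≤y = *-mono-≤ (s≤s x≤y) (s≤s x≤y)

root<bound : ∀ {n k} a x → n ≤ square⁺ k → a + square⁺ x < n → x < k
root<bound a x n≤k² a+x²<n = ≰⇒> λ k≤x →
  <⇒≱ a+x²<n (≤-trans n≤k² (≤-trans (square⁺-mono-≤ k≤x) (m≤n+m (square⁺ x) a)))

MonoSquareAt : ∀ {c n} → Coloring c n → Fin n → ℕ → Set
MonoSquareAt {n = n} χ i x = Σ[ j ∈ Fin n ] (toℕ j ≡ toℕ i + square⁺ x × χ i ≡ χ j)

monoSquareAt? : ∀ {c n} (χ : Coloring c n) i x → Dec (MonoSquareAt χ i x)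
monoSquareAt? {n = n} χ i x with toℕ i + square⁺ x <? n
... | no i+x²≮n = no λ (j , j≡i+x² , _) → i+x²≮n (subst (_< n) j≡i+x² (toℕ<n j))
... | yes i+x²<n = map′ (λ χi≡χj → j , toℕ-fromℕ< i+x²<n , χi≡χj) only-j (χ i ≟ χ j)
  where
  j = fromℕ< i+x²<n
  only-j : MonoSquareAt χ i x → χ i ≡ χ j
  only-j (j′ , j′≡i+x² , χi≡χj′) =
    trans χi≡χj′ (cong χ (toℕ-injective (trans j′≡i+x² (sym (toℕ-fromℕ< i+x²<n)))))

hasMonoSquarePair? : ∀ {c n} k → n ≤ square⁺ k → (χ : Coloring c n) → Dec (HasMonoSquarePair χ)
hasMonoSquarePair? {n = n} k n≤k² χ =
  map′ fromSearch toSearch (any? λ i → any? λ x → monoSquareAt? χ i (toℕ x))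
  where
  fromSearch : ∃[ i ] ∃[ x ] MonoSquareAt χ i (toℕ {k} x) → HasMonoSquarePair χ
  fromSearch (i , x , j , j≡i+x² , χi≡χj) = i , j , (toℕ x , cong suc j≡i+x²) , χi≡χj

  toSearch : HasMonoSquarePair χ → ∃[ i ] ∃[ x ] MonoSquareAt χ i (toℕ {k} x)
  toSearch (i , j , (x , 1+j≡1+i+x²) , χi≡χj) =
    i , fromℕ< x<k , j , trans j≡i+x² (cong (λ y → toℕ i + square⁺ y) (sym (toℕ-fromℕ< x<k))) , χi≡χj
    where
    j≡i+x² = suc-injective 1+j≡1+i+x²
    x<k = root<bound (toℕ i) x n≤k² (subst (_< n) j≡i+x² (toℕ<n j))

-- Overloaded literals, so the table can list colours as numerals; the ℕ instance keeps
-- ordinary literals working once fromNat is in scope (its constraint ⊤ is met by tt).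
instance
  natNumber : Number ℕ
  natNumber = ℕ.number

  finNumber : ∀ {n} → Number (Fin n)
  finNumber {n} = Fin.number n

witnessColoring : Vec (Fin 6) 333
witnessColoring =
  1 ∷ 3 ∷ 4 ∷ 2 ∷ 3 ∷ 5 ∷ 3 ∷ 1 ∷ 2 ∷ 0 ∷ 5 ∷ 3 ∷ 1 ∷ 4 ∷ 3 ∷ 0 ∷ 4 ∷ 0 ∷ 1 ∷ 3 ∷ 1 ∷ 2 ∷ 0 ∷ 5 ∷ 4 ∷ 5 ∷ 2 ∷ 0 ∷ 5 ∷ 0 ∷ 1 ∷ 2 ∷ 0 ∷ 5 ∷ 4 ∷ 1 ∷ 2 ∷
  4 ∷ 2 ∷ 0 ∷ 5 ∷ 3 ∷ 1 ∷ 2 ∷ 0 ∷ 5 ∷ 3 ∷ 1 ∷ 2 ∷ 3 ∷ 0 ∷ 3 ∷ 1 ∷ 2 ∷ 3 ∷ 5 ∷ 3 ∷ 1 ∷ 4 ∷ 3 ∷ 2 ∷ 4 ∷ 0 ∷ 5 ∷ 3 ∷ 1 ∷ 2 ∷ 0 ∷ 5 ∷ 3 ∷ 1 ∷ 2 ∷ 0 ∷ 5 ∷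
  0 ∷ 1 ∷ 4 ∷ 0 ∷ 5 ∷ 4 ∷ 1 ∷ 2 ∷ 4 ∷ 2 ∷ 0 ∷ 5 ∷ 3 ∷ 1 ∷ 2 ∷ 0 ∷ 5 ∷ 3 ∷ 1 ∷ 4 ∷ 2 ∷ 0 ∷ 4 ∷ 3 ∷ 1 ∷ 3 ∷ 5 ∷ 0 ∷ 5 ∷ 4 ∷ 1 ∷ 2 ∷ 4 ∷ 0 ∷ 5 ∷ 3 ∷ 1 ∷
  2 ∷ 0 ∷ 5 ∷ 4 ∷ 1 ∷ 2 ∷ 4 ∷ 2 ∷ 0 ∷ 5 ∷ 3 ∷ 1 ∷ 2 ∷ 0 ∷ 1 ∷ 3 ∷ 1 ∷ 2 ∷ 3 ∷ 5 ∷ 3 ∷ 1 ∷ 2 ∷ 0 ∷ 4 ∷ 3 ∷ 1 ∷ 4 ∷ 3 ∷ 2 ∷ 4 ∷ 0 ∷ 5 ∷ 3 ∷ 1 ∷ 2 ∷ 0 ∷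
  5 ∷ 4 ∷ 5 ∷ 2 ∷ 0 ∷ 5 ∷ 0 ∷ 1 ∷ 4 ∷ 0 ∷ 5 ∷ 4 ∷ 1 ∷ 2 ∷ 4 ∷ 2 ∷ 0 ∷ 5 ∷ 3 ∷ 1 ∷ 2 ∷ 0 ∷ 5 ∷ 3 ∷ 1 ∷ 4 ∷ 3 ∷ 0 ∷ 3 ∷ 1 ∷ 2 ∷ 3 ∷ 5 ∷ 3 ∷ 5 ∷ 4 ∷ 3 ∷
  2 ∷ 4 ∷ 0 ∷ 5 ∷ 3 ∷ 1 ∷ 2 ∷ 0 ∷ 5 ∷ 4 ∷ 1 ∷ 2 ∷ 0 ∷ 2 ∷ 0 ∷ 1 ∷ 4 ∷ 0 ∷ 5 ∷ 4 ∷ 1 ∷ 2 ∷ 4 ∷ 2 ∷ 0 ∷ 5 ∷ 3 ∷ 1 ∷ 2 ∷ 0 ∷ 5 ∷ 3 ∷ 1 ∷ 4 ∷ 3 ∷ 2 ∷ 4 ∷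
  3 ∷ 1 ∷ 3 ∷ 5 ∷ 0 ∷ 5 ∷ 4 ∷ 0 ∷ 2 ∷ 4 ∷ 0 ∷ 5 ∷ 3 ∷ 1 ∷ 4 ∷ 0 ∷ 5 ∷ 4 ∷ 1 ∷ 2 ∷ 4 ∷ 2 ∷ 0 ∷ 5 ∷ 3 ∷ 1 ∷ 2 ∷ 0 ∷ 1 ∷ 3 ∷ 1 ∷ 2 ∷ 3 ∷ 5 ∷ 3 ∷ 1 ∷ 2 ∷
  0 ∷ 4 ∷ 3 ∷ 1 ∷ 4 ∷ 3 ∷ 2 ∷ 4 ∷ 0 ∷ 5 ∷ 3 ∷ 1 ∷ 2 ∷ 0 ∷ 5 ∷ 4 ∷ 5 ∷ 2 ∷ 0 ∷ 5 ∷ 0 ∷ 1 ∷ 4 ∷ 0 ∷ 5 ∷ 4 ∷ 5 ∷ 2 ∷ 4 ∷ 2 ∷ 0 ∷ 5 ∷ 3 ∷ 1 ∷ 2 ∷ 0 ∷ 5 ∷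
  3 ∷ 1 ∷ 4 ∷ 3 ∷ 2 ∷ 3 ∷ 1 ∷ 2 ∷ 3 ∷ 5 ∷ 3 ∷ 5 ∷ 4 ∷ 3 ∷ 1 ∷ 4 ∷ 0 ∷ 5 ∷ 3 ∷ 1 ∷ 4 ∷ 0 ∷ 5 ∷ 4 ∷ 1 ∷ 2 ∷ 0 ∷ 2 ∷ 0 ∷ 1 ∷ 2 ∷ 0 ∷ 5 ∷ 4 ∷ 1 ∷ 2 ∷ 1 ∷ []

mainTheorem7 : VdSquareExceeds 6 333
mainTheorem7 = χ , from-no (hasMonoSquarePair? 18 (from-yes (333 ≤? square⁺ 18)) χ)
  where
  χ : Coloring 6 333
  χ = lookup witnessColoring
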